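{- Let $G_1,G_2,G_3$ be finite groups and $H\le G_1\times G_2\times G_3$ an almost-direct product of $G_1,G_2,G_3$. Let $N_1=\{\pi_1\in G_1:(\pi_1,1,1)\in H\}$, $N_2=\{\pi_2\in G_2:(1,\pi_2,1)\in H\}$, $N_3=\{\pi_3\in G_3:(1,1,\pi_3)\in H\}$ (normal subgroups of $G_1,G_2,G_3$ respectively), and $N=N_1\times N_2\times N_3$ (a normal subgroup of $H$). Then the quotient group $H/N$, viewed as a subgroup of $(G_1/N_1)\times(G_2/N_2)\times(G_3/N_3)$, is a strict almost-direct product of $G_1/N_1$, $G_2/N_2$, $G_3/N_3$.
   Context: For finite groups $G_1,G_2,G_3$, a subgroup $H\le G_1\times G_2\times G_3$ is an almost-direct product of $G_1,G_2,G_3$ if: (i) $H\ne G_1\times G_2\times G_3$; (ii) for all $\pi_2\in G_2,\pi_3\in G_3$ there is $\pi_1\in G_1$ with $(\pi_1,\pi_2,\pi_3)\in H$; (iii) for all $\pi_1\in G_1,\pi_3\in G_3$ there is $\pi_2\in G_2$ with $(\pi_1,\pi_2,\pi_3)\in H$; (iv) for all $\pi_1\in G_1,\pi_2\in G_2$ there is $\pi_3\in G_3$ with $(\pi_1,\pi_2,\pi_3)\in H$. It is strict if moreover the element $\pi_1$ in (ii), $\pi_2$ in (iii) and $\pi_3$ in (iv) is uniquely determined. -}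

module Defs where

open import Level using (Level; _⊔_; suc)
open import Algebra.Bundles using (Group)
open import Data.Nat using (ℕ)
open import Data.Fin using (Fin)
open import Data.Product using (Σ; ∃; ∃-syntax; _×_; _,_)
open import Relation.Nullary using (¬_)

private
  variable
    c ℓ c₁ ℓ₁ c₂ ℓ₂ c₃ ℓ₃ a₁ a₂ a₃ r₁ r₂ r₃ h : Level

IsFiniteGroup : Group c ℓ → Set (c ⊔ ℓ)
IsFiniteGroup G = ∃[ n ] Σ (Fin n → Carrier) λ f → ∀ x → ∃[ i ] f i ≈ x
  where open Group G

record IsSubgroup₃ (G₁ : Group c₁ ℓ₁) (G₂ : Group c₂ ℓ₂) (G₃ : Group c₃ ℓ₃)
       (H : Group.Carrier G₁ → Group.Carrier G₂ → Group.Carrier G₃ → Set h)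
       : Set (c₁ ⊔ ℓ₁ ⊔ c₂ ⊔ ℓ₂ ⊔ c₃ ⊔ ℓ₃ ⊔ h) where
  private
    module G₁ = Group G₁
    module G₂ = Group G₂
    module G₃ = Group G₃
  field
    resp : ∀ {x₁ y₁ x₂ y₂ x₃ y₃} → x₁ G₁.≈ y₁ → x₂ G₂.≈ y₂ → x₃ G₃.≈ y₃ →
           H x₁ x₂ x₃ → H y₁ y₂ y₃
    ε∈   : H G₁.ε G₂.ε G₃.ε
    ∙∈   : ∀ {x₁ y₁ x₂ y₂ x₃ y₃} → H x₁ x₂ x₃ → H y₁ y₂ y₃ →
           H (x₁ G₁.∙ y₁) (x₂ G₂.∙ y₂) (x₃ G₃.∙ y₃)
    ⁻¹∈  : ∀ {x₁ x₂ x₃} → H x₁ x₂ x₃ → H (x₁ G₁.⁻¹) (x₂ G₂.⁻¹) (x₃ G₃.⁻¹)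

record AlmostDirect {A₁ : Set a₁} {A₂ : Set a₂} {A₃ : Set a₃}
       (P : A₁ → A₂ → A₃ → Set h) : Set (a₁ ⊔ a₂ ⊔ a₃ ⊔ h) where
  field
    proper : ¬ (∀ x₁ x₂ x₃ → P x₁ x₂ x₃)
    fill₁  : ∀ x₂ x₃ → ∃[ x₁ ] P x₁ x₂ x₃
    fill₂  : ∀ x₁ x₃ → ∃[ x₂ ] P x₁ x₂ x₃
    fill₃  : ∀ x₁ x₂ → ∃[ x₃ ] P x₁ x₂ x₃

record StrictAlmostDirect {A₁ : Set a₁} {A₂ : Set a₂} {A₃ : Set a₃}
       (_≈₁_ : A₁ → A₁ → Set r₁) (_≈₂_ : A₂ → A₂ → Set r₂) (_≈₃_ : A₃ → A₃ → Set r₃)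
       (P : A₁ → A₂ → A₃ → Set h)
       : Set (a₁ ⊔ a₂ ⊔ a₃ ⊔ r₁ ⊔ r₂ ⊔ r₃ ⊔ h) where
  field
    almostDirect : AlmostDirect P
    unique₁ : ∀ {x₁ y₁ x₂ x₃} → P x₁ x₂ x₃ → P y₁ x₂ x₃ → x₁ ≈₁ y₁
    unique₂ : ∀ {x₁ x₂ y₂ x₃} → P x₁ x₂ x₃ → P x₁ y₂ x₃ → x₂ ≈₂ y₂
    unique₃ : ∀ {x₁ x₂ x₃ y₃} → P x₁ x₂ x₃ → P x₁ x₂ y₃ → x₃ ≈₃ y₃

module _ {G₁ : Group c₁ ℓ₁} {G₂ : Group c₂ ℓ₂} {G₃ : Group c₃ ℓ₃}
         (H : Group.Carrier G₁ → Group.Carrier G₂ → Group.Carrier G₃ → Set h) where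
  private
    module G₁ = Group G₁
    module G₂ = Group G₂
    module G₃ = Group G₃

  N₁ : G₁.Carrier → Set h
  N₁ x = H x G₂.ε G₃.ε
  N₂ : G₂.Carrier → Set h
  N₂ x = H G₁.ε x G₃.ε
  N₃ : G₃.Carrier → Set h
  N₃ x = H G₁.ε G₂.ε x

  -- Equality in the quotient Gᵢ/Nᵢ (elements represented by elements of Gᵢ):
  -- x ~ y  iff  x⁻¹ y ∈ Nᵢ  (i.e. x Nᵢ = y Nᵢ).
  _~₁_ : G₁.Carrier → G₁.Carrier → Set h
  x ~₁ y = N₁ ((x G₁.⁻¹) G₁.∙ y)
  _~₂_ : G₂.Carrier → G₂.Carrier → Set h
  x ~₂ y = N₂ ((x G₂.⁻¹) G₂.∙ y)
  _~₃_ : G₃.Carrier → G₃.Carrier → Set h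
  x ~₃ y = N₃ ((x G₃.⁻¹) G₃.∙ y)

  -- H/N viewed inside (G₁/N₁) × (G₂/N₂) × (G₃/N₃): the triple of cosets
  -- (x₁N₁, x₂N₂, x₃N₃) lies in H/N iff it is the image of some (h₁,h₂,h₃) ∈ H.
  HmodN : G₁.Carrier → G₂.Carrier → G₃.Carrier → Set (c₁ ⊔ c₂ ⊔ c₃ ⊔ h)
  HmodN x₁ x₂ x₃ = ∃[ h₁ ] ∃[ h₂ ] ∃[ h₃ ]
    (H h₁ h₂ h₃ × (h₁ ~₁ x₁) × (h₂ ~₂ x₂) × (h₃ ~₃ x₃))

-- H/N is just H again: H is a union of N-cosets, since for h ∈ H and
-- n ∈ N₁ × N₂ × N₃ also hn ∈ H.  Hence H/N inherits properness and the
-- filling properties from H.  Strictness: if (x₁,x₂,x₃) and (y₁,x₂,x₃) lie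
-- in H, so does (x₁⁻¹y₁, 1, 1), i.e. x₁N₁ = y₁N₁.
module Submission where

open import Defs
open import Level using (Level; _⊔_)
open import Algebra.Bundles using (Group)
open import Data.Product using (_,_; map₂)
import Algebra.Properties.Group as GroupProperties

module _ {a₁ a₂ a₃ h h′} {A₁ : Set a₁} {A₂ : Set a₂} {A₃ : Set a₃}
         {P : A₁ → A₂ → A₃ → Set h} {Q : A₁ → A₂ → A₃ → Set h′} where

  almostDirect-⇔ : (∀ {x₁ x₂ x₃} → P x₁ x₂ x₃ → Q x₁ x₂ x₃) →
                   (∀ {x₁ x₂ x₃} → Q x₁ x₂ x₃ → P x₁ x₂ x₃) →
                   AlmostDirect P → AlmostDirect Q
  almostDirect-⇔ P⇒Q Q⇒P ad = record
    { proper = λ allQ → proper (λ x₁ x₂ x₃ → Q⇒P (allQ x₁ x₂ x₃))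
    ; fill₁  = λ x₂ x₃ → map₂ P⇒Q (fill₁ x₂ x₃)
    ; fill₂  = λ x₁ x₃ → map₂ P⇒Q (fill₂ x₁ x₃)
    ; fill₃  = λ x₁ x₂ → map₂ P⇒Q (fill₃ x₁ x₂)
    }
    where open AlmostDirect ad

module _ {c₁ ℓ₁ c₂ ℓ₂ c₃ ℓ₃ h}
         {G₁ : Group c₁ ℓ₁} {G₂ : Group c₂ ℓ₂} {G₃ : Group c₃ ℓ₃}
         {H : Group.Carrier G₁ → Group.Carrier G₂ → Group.Carrier G₃ → Set h}
         (isSubgroup : IsSubgroup₃ G₁ G₂ G₃ H) where

  private
    module G₁ = Group G₁
    module G₂ = Group G₂
    module G₃ = Group G₃
    module P₁ = GroupProperties G₁
    module P₂ = GroupProperties G₂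
    module P₃ = GroupProperties G₃

    Nᴴ₁ : G₁.Carrier → Set h
    Nᴴ₁ = N₁ {G₁ = G₁} {G₂ = G₂} {G₃ = G₃} H
    Nᴴ₂ : G₂.Carrier → Set h
    Nᴴ₂ = N₂ {G₁ = G₁} {G₂ = G₂} {G₃ = G₃} H
    Nᴴ₃ : G₃.Carrier → Set h
    Nᴴ₃ = N₃ {G₁ = G₁} {G₂ = G₂} {G₃ = G₃} H

    HmodNᴴ : G₁.Carrier → G₂.Carrier → G₃.Carrier → Set (c₁ ⊔ c₂ ⊔ c₃ ⊔ h)
    HmodNᴴ = HmodN {G₁ = G₁} {G₂ = G₂} {G₃ = G₃} H

  open IsSubgroup₃ isSubgroup

  N₁×N₂×N₃⊆H : ∀ {n₁ n₂ n₃} → Nᴴ₁ n₁ → Nᴴ₂ n₂ → Nᴴ₃ n₃ → H n₁ n₂ n₃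
  N₁×N₂×N₃⊆H {n₁} {n₂} {n₃} p₁ p₂ p₃ = resp
    (G₁.trans (G₁.identityʳ _) (G₁.identityʳ n₁))
    (G₂.trans (G₂.identityʳ _) (G₂.identityˡ n₂))
    (G₃.trans (G₃.∙-congʳ (G₃.identityˡ G₃.ε)) (G₃.identityˡ n₃))
    (∙∈ (∙∈ p₁ p₂) p₃)

  HmodN⇒H : ∀ {x₁ x₂ x₃} → HmodNᴴ x₁ x₂ x₃ → H x₁ x₂ x₃
  HmodN⇒H (h₁ , h₂ , h₃ , h∈H , n₁ , n₂ , n₃) = resp
    (P₁.\\-leftDividesˡ h₁ _) (P₂.\\-leftDividesˡ h₂ _) (P₃.\\-leftDividesˡ h₃ _)
    (∙∈ h∈H (N₁×N₂×N₃⊆H n₁ n₂ n₃))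

  H⇒HmodN : ∀ {x₁ x₂ x₃} → H x₁ x₂ x₃ → HmodNᴴ x₁ x₂ x₃
  H⇒HmodN {x₁} {x₂} {x₃} x∈H = x₁ , x₂ , x₃ , x∈H ,
    resp (G₁.sym (G₁.inverseˡ x₁)) G₂.refl G₃.refl ε∈ ,
    resp G₁.refl (G₂.sym (G₂.inverseˡ x₂)) G₃.refl ε∈ ,
    resp G₁.refl G₂.refl (G₃.sym (G₃.inverseˡ x₃)) ε∈

  \\-∈ : ∀ {x₁ x₂ x₃ y₁ y₂ y₃} → H x₁ x₂ x₃ → H y₁ y₂ y₃ →
         H (x₁ G₁.\\ y₁) (x₂ G₂.\\ y₂) (x₃ G₃.\\ y₃)
  \\-∈ x∈H y∈H = ∙∈ (⁻¹∈ x∈H) y∈H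

  HmodN-strict : AlmostDirect H →
                 StrictAlmostDirect (_~₁_ {G₁ = G₁} {G₂ = G₂} {G₃ = G₃} H)
                                    (_~₂_ {G₁ = G₁} {G₂ = G₂} {G₃ = G₃} H)
                                    (_~₃_ {G₁ = G₁} {G₂ = G₂} {G₃ = G₃} H)
                                    HmodNᴴ
  HmodN-strict ad = record
    { almostDirect = almostDirect-⇔ H⇒HmodN HmodN⇒H ad
    ; unique₁ = λ p q → resp G₁.refl (G₂.inverseˡ _) (G₃.inverseˡ _) (divide p q)
    ; unique₂ = λ p q → resp (G₁.inverseˡ _) G₂.refl (G₃.inverseˡ _) (divide p q)
    ; unique₃ = λ p q → resp (G₁.inverseˡ _) (G₂.inverseˡ _) G₃.refl (divide p q)
    }
    where
      divide : ∀ {x₁ x₂ x₃ y₁ y₂ y₃} → HmodNᴴ x₁ x₂ x₃ → HmodNᴴ y₁ y₂ y₃ →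
               H (x₁ G₁.\\ y₁) (x₂ G₂.\\ y₂) (x₃ G₃.\\ y₃)
      divide p q = \\-∈ (HmodN⇒H p) (HmodN⇒H q)

lemma2 : ∀ {c₁ ℓ₁ c₂ ℓ₂ c₃ ℓ₃ h : Level}
    (G₁ : Group c₁ ℓ₁) (G₂ : Group c₂ ℓ₂) (G₃ : Group c₃ ℓ₃) →
    IsFiniteGroup G₁ → IsFiniteGroup G₂ → IsFiniteGroup G₃ →
    (H : Group.Carrier G₁ → Group.Carrier G₂ → Group.Carrier G₃ → Set h) →
    IsSubgroup₃ G₁ G₂ G₃ H →
    AlmostDirect H →
    StrictAlmostDirect (_~₁_ {G₁ = G₁} {G₂ = G₂} {G₃ = G₃} H)
                       (_~₂_ {G₁ = G₁} {G₂ = G₂} {G₃ = G₃} H)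
                       (_~₃_ {G₁ = G₁} {G₂ = G₂} {G₃ = G₃} H)
                       (HmodN {G₁ = G₁} {G₂ = G₂} {G₃ = G₃} H)
lemma2 _ _ _ _ _ _ _ isSubgroup = HmodN-strict isSubgroup
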